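{- Let $\Gamma$ be a finite nilpotent group and $\Sigma$ a subgroup of $\Gamma$. Let $\delta\in\Gamma$ satisfy $\delta\Sigma\delta^{ -1}\neq\Sigma$. If $\Sigma\delta\Sigma=\Sigma\delta^{ -1}\Sigma$, then $|\Sigma:\Sigma\cap\delta\Sigma\delta^{ -1}|$ is even.
   Context: All groups are finite. -}

module Defs where

open import Level using (0ℓ)
open import Data.Nat using (ℕ; zero; suc; _*_)
open import Data.Fin using (Fin)
open import Data.Fin.Subset using (Subset; _∈_; _∩_; ∣_∣)
open import Data.Vec using (tabulate; lookup)
open import Data.Product using (Σ; ∃; _×_; _,_)
open import Function.Bundles using (_⇔_)
open import Relation.Binary.PropositionalEquality using (_≡_)
open import Algebra.Structures using (IsGroup)

-- A finite group: a group structure (stdlib's IsGroup) on the carrier Fin n,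
-- with propositional equality.  Every finite group is isomorphic to one of these.
record FiniteGroup : Set where
  field
    order   : ℕ
    _∙_     : Fin order → Fin order → Fin order
    ε       : Fin order
    _⁻¹     : Fin order → Fin order
    isGroup : IsGroup (_≡_ {A = Fin order}) _∙_ ε _⁻¹
  infixl 7 _∙_
  infix 8 _⁻¹

  Elt : Set
  Elt = Fin order

  [_,_] : Elt → Elt → Elt
  [ x , g ] = x ⁻¹ ∙ g ⁻¹ ∙ x ∙ g

  -- upper central series: Z 0 = {ε}, Z (i+1) = {x | ∀ g, [x,g] ∈ Z i}
  -- (i.e. Z (i+1) / Z i = centre of G / Z i)
  UpperCentral : ℕ → Elt → Set
  UpperCentral zero    x = x ≡ ε
  UpperCentral (suc i) x = ∀ g → UpperCentral i [ x , g ]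

  IsNilpotent : Set
  IsNilpotent = ∃ λ c → ∀ x → UpperCentral c x

  record IsSubgroup (S : Subset order) : Set where
    field
      ε-∈   : ε ∈ S
      ∙-∈   : ∀ {x y} → x ∈ S → y ∈ S → x ∙ y ∈ S
      ⁻¹-∈  : ∀ {x} → x ∈ S → x ⁻¹ ∈ S

  -- the conjugate subset δ S δ⁻¹ = { x | δ⁻¹ x δ ∈ S }
  conj : Elt → Subset order → Subset order
  conj δ S = tabulate (λ x → lookup S (δ ⁻¹ ∙ x ∙ δ))

  SameSet : Subset order → Subset order → Set
  SameSet A B = ∀ x → (x ∈ A) ⇔ (x ∈ B)

  InDoubleCoset : Subset order → Elt → Elt → Set
  InDoubleCoset S δ x = Σ Elt λ s → Σ Elt λ t → s ∈ S × t ∈ S × x ≡ s ∙ δ ∙ t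

  -- the index |S : H| (for H ≤ S) is even: |S| = (2k)·|H| for some k
  IndexEven : Subset order → Subset order → Set
  IndexEven S H = ∃ λ k → ∣ S ∣ ≡ (2 * k) * ∣ H ∣

-- Write T = δSδ⁻¹ and H = S ∩ T.  Since δ⁻¹ ∈ SδS we have δ⁻¹ = sδt with s, t ∈ S, and g = δt
-- satisfies gSg⁻¹ = T and g² = s⁻¹t ∈ S.  Suppose |S : H| is odd; we show S ⊆ T, and then
-- T ⊆ S by conjugating with g² ∈ S, contradicting T ≠ S.
--
-- Every element is a product of commuting 2-part and odd part, both powers of it, and in a
-- nilpotent group 2-elements commute with elements of odd order (modulo Z j, commutators with
-- an entry in Z (j + 1) are multiplicative in each entry).  An odd-order y ∈ S lies in T because
-- conjugation by g agrees on y with conjugation by the odd part of g, a power of g² ∈ S.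
-- A 2-element x ∈ S acts on the odd number |S : H| of left cosets of H in S, so it fixes one,
-- say s⁻¹xs ∈ H.  By induction along the upper central series the 2-part p of [x , s] lies in
-- T, hence so does x q = (s⁻¹xs) p⁻¹ for the odd part q; as x commutes with q, x ^ (2m+1) =
-- (x q) ^ (2m+1) ∈ T, which together with x ^ (2 ^ a) = 1 gives x ∈ T.

module Submission where

open import Level using (0ℓ)
open import Data.Bool using (Bool; true; false; not; if_then_else_)
import Data.Bool.Properties as Bool
open import Data.Nat using (ℕ; zero; suc; _+_; _*_; _≤_; _<_; s≤s; z≤n)
import Data.Nat as ℕ
open import Data.Nat.Properties
  using (+-0-commutativeMonoid; +-identityʳ; +-assoc; +-suc; *-comm; *-assoc; *-suc; *-identityˡ;
         ≤-trans; m≤m+n; m≤n+m; m<m+n; n<1+n; m≤n⇒∃[o]m+o≡n)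
open import Data.Nat.Binary.Base as Bin using (2[1+_]; 1+[2_])
open import Data.Nat.Binary.Properties using (toℕ-fromℕ)
open import Data.Nat.Divisibility using (_∣?_; divides)
open import Data.Nat.Induction using (<-wellFounded)
open import Data.Nat.Tactic.RingSolver using (solve-∀)
open import Data.Fin using (Fin; zero; suc; toℕ)
import Data.Fin.Properties as Fin
open import Data.Fin.Permutation using (permutation)
open import Data.Fin.Subset using (Subset; _∈_; _∉_; _∩_; ∣_∣)
open import Data.Fin.Subset.Properties using (_∈?_; x∈p∩q⁺; x∈p∩q⁻; ⊆-antisym)
open import Data.List using (List; []; _∷_)
open import Data.Product using (∃; ∃₂; _×_; _,_; proj₁; proj₂)
import Data.Product as Product
open import Data.Vec using (Vec; []; _∷_; lookup)
open import Data.Vec.Properties using ([]=⇒lookup; lookup⇒[]=; lookup∘tabulate)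
open import Function.Base using (_∘_)
open import Function.Bundles using (_⇔_; mk⇔; Equivalence)
open import Induction.WellFounded using (Acc; acc)
open import Relation.Binary.Core using (Rel)
open import Relation.Binary.Structures using (IsDecEquivalence)
open import Relation.Binary.PropositionalEquality hiding ([_])
open import Relation.Nullary using (¬_; Dec; yes; no; does; contradiction)
open import Relation.Nullary.Decidable using (¬?; _×-dec_; decidable-stable)
import Relation.Nullary.Decidable as Dec
open import Relation.Unary using (Pred; Decidable)
open import Relation.Unary.Properties using (_∩?_; ∁?)
open import Algebra.Bundles using (Group)
open import Algebra.Structures using (IsGroup)
import Algebra.Properties.Group as GroupProperties
import Algebra.Properties.Monoid.Mult as MonoidMult
open import Algebra.Properties.CommutativeMonoid.Sum +-0-commutativeMonoid
  using (sum; sum-cong-≗; ∑-distrib-+; ∑-permute; sum-replicate-zero)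
open import Defs

k*[2h]≡2k*h : ∀ k h → k * (2 * h) ≡ 2 * k * h
k*[2h]≡2k*h = solve-∀

2Kh+2kh≡2[K+k]h : ∀ K k h → 2 * K * h + 2 * k * h ≡ 2 * (K + k) * h
2Kh+2kh≡2[K+k]h = solve-∀

c+2kh+[h+h]≡c+2[1+k]h : ∀ c k h → c + 2 * k * h + (h + h) ≡ c + 2 * suc k * h
c+2kh+[h+h]≡c+2[1+k]h = solve-∀

2-adic-decomposition : ∀ n → ∃₂ λ a m → suc n ≡ 2 ℕ.^ a * suc (2 * m)
2-adic-decomposition n = subst (λ k → ∃₂ λ a m → suc k ≡ 2 ℕ.^ a * suc (2 * m)) (toℕ-fromℕ n) (binary (Bin.fromℕ n))
  where
  binary : ∀ x → ∃₂ λ a m → suc (Bin.toℕ x) ≡ 2 ℕ.^ a * suc (2 * m)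
  binary Bin.zero = 0 , 0 , refl
  binary 2[1+ x ] = 0 , suc (Bin.toℕ x) , sym (*-identityˡ _)
  binary 1+[2 x ] with a , m , eq ← binary x = suc a , m , (begin
    suc (suc (2 * Bin.toℕ x))    ≡⟨ cong suc (sym (+-suc (Bin.toℕ x) (Bin.toℕ x + 0))) ⟩
    2 * suc (Bin.toℕ x)          ≡⟨ cong (2 *_) eq ⟩
    2 * (2 ℕ.^ a * suc (2 * m))  ≡⟨ sym (*-assoc 2 (2 ℕ.^ a) _) ⟩
    2 ℕ.^ suc a * suc (2 * m)    ∎)
    where open ≡-Reasoning

indicator : ∀ {p} {P : Set p} → Dec P → ℕ
indicator P? = if does P? then 1 else 0

count : ∀ {n} {P : Pred (Fin n) 0ℓ} → Decidable P → ℕ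
count P? = sum (indicator ∘ P?)

module _ {n} {P Q : Pred (Fin n) 0ℓ} (P? : Decidable P) (Q? : Decidable Q) where

  count-cong : (∀ {i} → P i → Q i) → (∀ {i} → Q i → P i) → count P? ≡ count Q?
  count-cong P⊆Q Q⊆P = sum-cong-≗ pointwise
    where
    pointwise : ∀ i → indicator (P? i) ≡ indicator (Q? i)
    pointwise i with P? i | Q? i
    ... | yes _  | yes _  = refl
    ... | no  _  | no  _  = refl
    ... | yes Pi | no ¬Qi = contradiction (P⊆Q Pi) ¬Qi
    ... | no ¬Pi | yes Qi = contradiction (Q⊆P Qi) ¬Pi

  count-split : (∀ {i} → Q i → P i) → count P? ≡ count (P? ∩? ∁? Q?) + count Q?
  count-split Q⊆P = trans (sum-cong-≗ pointwise) (∑-distrib-+ (indicator ∘ (P? ∩? ∁? Q?)) (indicator ∘ Q?))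
    where
    pointwise : ∀ i → indicator (P? i) ≡ indicator ((P? ∩? ∁? Q?) i) + indicator (Q? i)
    pointwise i with P? i | Q? i
    ... | yes _  | yes _  = refl
    ... | yes _  | no  _  = refl
    ... | no  _  | no  _  = refl
    ... | no ¬Pi | yes Qi = contradiction (Q⊆P Qi) ¬Pi

module _ {n} {P : Pred (Fin n) 0ℓ} (P? : Decidable P) where

  count-∅ : (∀ i → ¬ P i) → count P? ≡ 0
  count-∅ ¬P = trans (sum-cong-≗ pointwise) (sum-replicate-zero n)
    where
    pointwise : ∀ i → indicator (P? i) ≡ 0
    pointwise i with P? i
    ... | yes Pi = contradiction Pi (¬P i)
    ... | no  _  = refl

  count-∘-bijection : ∀ (f g : Fin n → Fin n) → (∀ i → f (g i) ≡ i) → (∀ i → g (f i) ≡ i) → count (P? ∘ f) ≡ count P?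
  count-∘-bijection f g f∘g g∘f = sym (∑-permute (indicator ∘ P?) (permutation f g f∘g g∘f))

count-pos : ∀ {n} {P : Pred (Fin n) 0ℓ} (P? : Decidable P) {i} → P i → 1 ≤ count P?
count-pos P? {zero} P0 with P? zero
... | yes _   = s≤s z≤n
... | no ¬P0  = contradiction P0 ¬P0
count-pos P? {suc i} Pi = ≤-trans (count-pos (P? ∘ suc) Pi) (m≤n+m _ (indicator (P? zero)))

module ClassInvolution {n} {_∼_ : Rel (Fin n) 0ℓ} (isDecEquivalence : IsDecEquivalence _∼_)
                       (h : ℕ) (class-size : ∀ c → count (IsDecEquivalence._≟_ isDecEquivalence c) ≡ h)
                       (f : Fin n → Fin n) (f-cong : ∀ {u w} → u ∼ w → f u ∼ f w) where

  open IsDecEquivalence isDecEquivalence using (_≟_) renaming (refl to ∼-refl; sym to ∼-sym; trans to ∼-trans)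

  record Stable (B : Pred (Fin n) 0ℓ) : Set where
    field
      ∼-closed     : ∀ {u w} → B u → u ∼ w → B w
      f-closed     : ∀ {u} → B u → B (f u)
      f-involutive : ∀ {u} → B u → f (f u) ∼ u

  fixed? : Decidable (λ u → u ∼ f u)
  fixed? u = u ≟ f u

  module WithoutPair {B : Pred (Fin n) 0ℓ} (B? : Decidable B) (B-stable : Stable B)
                     {b} (Bb : B b) (b≁fb : ¬ b ∼ f b) where
    open Stable B-stable

    B∖C : Pred (Fin n) 0ℓ
    B∖C u = B u × ¬ b ∼ u

    B∖C? : Decidable B∖C
    B∖C? = B? ∩? ∁? (b ≟_)

    B′ : Pred (Fin n) 0ℓ
    B′ u = B∖C u × ¬ f b ∼ u

    B′? : Decidable B′
    B′? = B∖C? ∩? ∁? (f b ≟_)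

    count-B : count B? ≡ count B′? + (h + h)
    count-B = begin
      count B?                                    ≡⟨ count-split B? (b ≟_) (∼-closed Bb) ⟩
      count B∖C? + count (b ≟_)                   ≡⟨ cong (_+ count (b ≟_)) (count-split B∖C? (f b ≟_) [fb]⊆B∖C) ⟩
      count B′? + count (f b ≟_) + count (b ≟_)   ≡⟨ cong₂ (λ d c → count B′? + d + c) (class-size (f b)) (class-size b) ⟩
      count B′? + h + h                           ≡⟨ +-assoc (count B′?) h h ⟩
      count B′? + (h + h)                         ∎
      where
      open ≡-Reasoning
      [fb]⊆B∖C : ∀ {u} → f b ∼ u → B∖C u
      [fb]⊆B∖C fb∼u = ∼-closed (f-closed Bb) fb∼u , λ b∼u → b≁fb (∼-trans b∼u (∼-sym fb∼u))

    count-B′<count-B : count B′? < count B?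
    count-B′<count-B = subst (count B′? <_) (sym count-B)
      (m<m+n (count B′?) (≤-trans (subst (1 ≤_) (class-size b) (count-pos (b ≟_) ∼-refl)) (m≤m+n h h)))

    B′-stable : Stable B′
    B′-stable = record
      { ∼-closed     = λ ((Bu , b≁u) , fb≁u) u∼w →
          (∼-closed Bu u∼w , λ b∼w → b≁u (∼-trans b∼w (∼-sym u∼w))) , λ fb∼w → fb≁u (∼-trans fb∼w (∼-sym u∼w))
      ; f-closed     = λ ((Bu , b≁u) , fb≁u) →
          (f-closed Bu , λ b∼fu → fb≁u (∼-trans (f-cong b∼fu) (f-involutive Bu))) ,
          λ fb∼fu → b≁u (∼-trans (∼-sym (f-involutive Bb)) (∼-trans (f-cong fb∼fu) (f-involutive Bu)))
      ; f-involutive = f-involutive ∘ proj₁ ∘ proj₁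
      }

    same-fixed : count (B′? ∩? fixed?) ≡ count (B? ∩? fixed?)
    same-fixed = count-cong (B′? ∩? fixed?) (B? ∩? fixed?) (λ (((Bu , _) , _) , u∼fu) → Bu , u∼fu)
      λ (Bu , u∼fu) →
        ((Bu , λ b∼u → b≁fb (∼-trans b∼u (∼-trans u∼fu (f-cong (∼-sym b∼u))))) ,
         λ fb∼u → b≁fb (∼-trans (∼-sym (f-involutive Bb)) (∼-trans (f-cong fb∼u) (∼-trans (∼-sym u∼fu) (∼-sym fb∼u))))) ,
        u∼fu

  -- Induction on |B|: remove the two classes of some b ∈ B with b ≁ f b, which f swaps.
  count≡fixed+pairs : ∀ {B : Pred (Fin n) 0ℓ} (B? : Decidable B) → Stable B →
                      ∃ λ k → count B? ≡ count (B? ∩? fixed?) + 2 * k * h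
  count≡fixed+pairs B? = go B? (<-wellFounded (count B?))
    where
    go : ∀ {B : Pred (Fin n) 0ℓ} (B? : Decidable B) → Acc _<_ (count B?) → Stable B →
         ∃ λ k → count B? ≡ count (B? ∩? fixed?) + 2 * k * h
    go {B} B? (acc rs) B-stable with Fin.any? (λ u → B? u ×-dec ¬? (fixed? u))
    ... | no ∄non-fixed = 0 , trans (count-cong B? (B? ∩? fixed?) (λ Bu → Bu , fixed Bu) proj₁) (sym (+-identityʳ _))
      where
      fixed : ∀ {u} → B u → u ∼ f u
      fixed {u} Bu = decidable-stable (fixed? u) (λ non-fixed → ∄non-fixed (u , Bu , non-fixed))
    ... | yes (b , Bb , b≁fb) = add-pair (go B′? (rs count-B′<count-B) B′-stable)
      where
      open WithoutPair B? B-stable Bb b≁fb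
      open ≡-Reasoning
      add-pair : (∃ λ k → count B′? ≡ count (B′? ∩? fixed?) + 2 * k * h) →
                 ∃ λ k → count B? ≡ count (B? ∩? fixed?) + 2 * k * h
      add-pair (k , eq) = suc k , (begin
        count B?                                         ≡⟨ count-B ⟩
        count B′? + (h + h)                              ≡⟨ cong (_+ (h + h)) eq ⟩
        count (B′? ∩? fixed?) + 2 * k * h + (h + h)      ≡⟨ cong (λ c → c + 2 * k * h + (h + h)) same-fixed ⟩
        count (B? ∩? fixed?) + 2 * k * h + (h + h)       ≡⟨ c+2kh+[h+h]≡c+2[1+k]h (count (B? ∩? fixed?)) k h ⟩
        count (B? ∩? fixed?) + 2 * suc k * h             ∎)

count-∈ : ∀ {n} (p : Subset n) → count (_∈? p) ≡ ∣ p ∣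
count-∈ []          = refl
count-∈ (true ∷ p)  = cong suc (count-∈ p)
count-∈ (false ∷ p) = count-∈ p

group : FiniteGroup → Group 0ℓ 0ℓ
group G = record { isGroup = FiniteGroup.isGroup G }

module GroupWords (G : FiniteGroup) where

  open FiniteGroup G using (Elt; _∙_; ε; _⁻¹; isGroup)
  open IsGroup isGroup using (assoc; identityˡ; identityʳ; inverseˡ)
  open GroupProperties (group G) using (ε⁻¹≈ε; ⁻¹-involutive; ⁻¹-anti-homo-∙)
  open ≡-Reasoning

  infixl 7 _·_
  infix 8 _′

  data Expr (n : ℕ) : Set where
    var : Fin n → Expr n
    e   : Expr n
    _·_ : Expr n → Expr n → Expr n
    _′  : Expr n → Expr n

  ⟦_⟧ : ∀ {n} → Expr n → Vec Elt n → Elt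
  ⟦ var i ⟧ ρ = lookup ρ i
  ⟦ e ⟧     ρ = ε
  ⟦ a · b ⟧ ρ = ⟦ a ⟧ ρ ∙ ⟦ b ⟧ ρ
  ⟦ a ′ ⟧   ρ = ⟦ a ⟧ ρ ⁻¹

  -- (i , false) stands for the inverse of the i-th variable
  Letter : ℕ → Set
  Letter n = Fin n × Bool

  ⟦_⟧ˡ : ∀ {n} → Letter n → Vec Elt n → Elt
  ⟦ i , true  ⟧ˡ ρ = lookup ρ i
  ⟦ i , false ⟧ˡ ρ = lookup ρ i ⁻¹

  ⟦_⟧ʷ : ∀ {n} → List (Letter n) → Vec Elt n → Elt
  ⟦ [] ⟧ʷ    ρ = ε
  ⟦ l ∷ w ⟧ʷ ρ = ⟦ l ⟧ˡ ρ ∙ ⟦ w ⟧ʷ ρ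

  cons : ∀ {n} → Letter n → List (Letter n) → List (Letter n)
  cons l [] = l ∷ []
  cons (i , s) ((j , t) ∷ w) with i Fin.≟ j | s Bool.≟ not t
  ... | yes refl | yes refl = w
  ... | _        | _        = (i , s) ∷ (j , t) ∷ w

  append : ∀ {n} → List (Letter n) → List (Letter n) → List (Letter n)
  append []      w = w
  append (l ∷ u) w = cons l (append u w)

  invert : ∀ {n} → List (Letter n) → List (Letter n)
  invert []            = []
  invert ((i , s) ∷ w) = append (invert w) ((i , not s) ∷ [])

  normalise : ∀ {n} → Expr n → List (Letter n)
  normalise (var i) = (i , true) ∷ []
  normalise e       = []
  normalise (a · b) = append (normalise a) (normalise b)
  normalise (a ′)   = invert (normalise a)

  ⟦not⟧ˡ : ∀ {n} (i : Fin n) s ρ → ⟦ i , not s ⟧ˡ ρ ≡ ⟦ i , s ⟧ˡ ρ ⁻¹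
  ⟦not⟧ˡ i true  ρ = refl
  ⟦not⟧ˡ i false ρ = sym (⁻¹-involutive _)

  cancel : ∀ x y → x ⁻¹ ∙ (x ∙ y) ≡ y
  cancel x y = trans (sym (assoc _ _ _)) (trans (cong (_∙ y) (inverseˡ x)) (identityˡ y))

  cons-correct : ∀ {n} (l : Letter n) w ρ → ⟦ cons l w ⟧ʷ ρ ≡ ⟦ l ⟧ˡ ρ ∙ ⟦ w ⟧ʷ ρ
  cons-correct l [] ρ = refl
  cons-correct (i , s) ((j , t) ∷ w) ρ with i Fin.≟ j | s Bool.≟ not t
  ... | yes refl | yes refl = sym (begin
    ⟦ i , not t ⟧ˡ ρ ∙ (⟦ i , t ⟧ˡ ρ ∙ ⟦ w ⟧ʷ ρ) ≡⟨ cong (_∙ (⟦ i , t ⟧ˡ ρ ∙ ⟦ w ⟧ʷ ρ)) (⟦not⟧ˡ i t ρ) ⟩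
    ⟦ i , t ⟧ˡ ρ ⁻¹ ∙ (⟦ i , t ⟧ˡ ρ ∙ ⟦ w ⟧ʷ ρ)  ≡⟨ cancel _ _ ⟩
    ⟦ w ⟧ʷ ρ                                     ∎)
  ... | yes refl | no _ = refl
  ... | no _     | _    = refl

  append-correct : ∀ {n} (u w : List (Letter n)) ρ → ⟦ append u w ⟧ʷ ρ ≡ ⟦ u ⟧ʷ ρ ∙ ⟦ w ⟧ʷ ρ
  append-correct []      w ρ = sym (identityˡ _)
  append-correct (l ∷ u) w ρ = begin
    ⟦ cons l (append u w) ⟧ʷ ρ      ≡⟨ cons-correct l (append u w) ρ ⟩
    ⟦ l ⟧ˡ ρ ∙ ⟦ append u w ⟧ʷ ρ    ≡⟨ cong (⟦ l ⟧ˡ ρ ∙_) (append-correct u w ρ) ⟩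
    ⟦ l ⟧ˡ ρ ∙ (⟦ u ⟧ʷ ρ ∙ ⟦ w ⟧ʷ ρ) ≡⟨ sym (assoc _ _ _) ⟩
    ⟦ l ⟧ˡ ρ ∙ ⟦ u ⟧ʷ ρ ∙ ⟦ w ⟧ʷ ρ   ∎

  invert-correct : ∀ {n} (w : List (Letter n)) ρ → ⟦ invert w ⟧ʷ ρ ≡ ⟦ w ⟧ʷ ρ ⁻¹
  invert-correct [] ρ = sym ε⁻¹≈ε
  invert-correct ((i , s) ∷ w) ρ = begin
    ⟦ append (invert w) ((i , not s) ∷ []) ⟧ʷ ρ  ≡⟨ append-correct (invert w) _ ρ ⟩
    ⟦ invert w ⟧ʷ ρ ∙ (⟦ i , not s ⟧ˡ ρ ∙ ε)     ≡⟨ cong₂ _∙_ (invert-correct w ρ) (trans (identityʳ _) (⟦not⟧ˡ i s ρ)) ⟩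
    ⟦ w ⟧ʷ ρ ⁻¹ ∙ ⟦ i , s ⟧ˡ ρ ⁻¹                 ≡⟨ sym (⁻¹-anti-homo-∙ _ _) ⟩
    (⟦ i , s ⟧ˡ ρ ∙ ⟦ w ⟧ʷ ρ) ⁻¹                  ∎

  normalise-correct : ∀ {n} (a : Expr n) ρ → ⟦ normalise a ⟧ʷ ρ ≡ ⟦ a ⟧ ρ
  normalise-correct (var i) ρ = identityʳ _
  normalise-correct e       ρ = refl
  normalise-correct (a · b) ρ = trans (append-correct (normalise a) (normalise b) ρ)
                                      (cong₂ _∙_ (normalise-correct a ρ) (normalise-correct b ρ))
  normalise-correct (a ′)   ρ = trans (invert-correct (normalise a) ρ) (cong _⁻¹ (normalise-correct a ρ))

  solve : ∀ {n} (a b : Expr n) → normalise a ≡ normalise b → ∀ ρ → ⟦ a ⟧ ρ ≡ ⟦ b ⟧ ρ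
  solve a b eq ρ = begin
    ⟦ a ⟧ ρ              ≡⟨ sym (normalise-correct a ρ) ⟩
    ⟦ normalise a ⟧ʷ ρ   ≡⟨ cong (λ w → ⟦ w ⟧ʷ ρ) eq ⟩
    ⟦ normalise b ⟧ʷ ρ   ≡⟨ normalise-correct b ρ ⟩
    ⟦ b ⟧ ρ              ∎

  x₀ : ∀ {n} → Expr (suc n)
  x₀ = var zero
  x₁ : ∀ {n} → Expr (suc (suc n))
  x₁ = var (suc zero)
  x₂ : ∀ {n} → Expr (suc (suc (suc n)))
  x₂ = var (suc (suc zero))
  x₃ : ∀ {n} → Expr (suc (suc (suc (suc n))))
  x₃ = var (suc (suc (suc zero)))

module _ (G : FiniteGroup) where

  open FiniteGroup G
  open IsGroup isGroup using (identityˡ; identityʳ; inverseˡ)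
  open GroupProperties (group G) using (ε⁻¹≈ε; ⁻¹-involutive; identityʳ-unique)
  open MonoidMult (Group.monoid (group G)) using (×-homo-+; ×-assocˡ) renaming (_×_ to _×ᴳ_)
  open GroupWords G
  open ≡-Reasoning

  infixr 8 _^_
  _^_ : Elt → ℕ → Elt
  x ^ n = n ×ᴳ x

  ^-+ : ∀ x m n → x ^ (m + n) ≡ x ^ m ∙ x ^ n
  ^-+ x m n = ×-homo-+ x m n

  ^-* : ∀ x m n → x ^ (m * n) ≡ (x ^ m) ^ n
  ^-* x m n = trans (cong (x ^_) (*-comm m n)) (sym (×-assocˡ x n m))

  ^-^-comm : ∀ x m n → (x ^ m) ^ n ≡ (x ^ n) ^ m
  ^-^-comm x m n = trans (sym (^-* x m n)) (trans (cong (x ^_) (*-comm m n)) (^-* x n m))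

  ε^ : ∀ n → ε ^ n ≡ ε
  ε^ zero    = refl
  ε^ (suc n) = trans (identityˡ _) (ε^ n)

  record IsSubgroupPred (K : Elt → Set) : Set where
    field
      ε-∈  : K ε
      ∙-∈  : ∀ {x y} → K x → K y → K (x ∙ y)
      ⁻¹-∈ : ∀ {x} → K x → K (x ⁻¹)

    ^-∈ : ∀ {x} n → K x → K (x ^ n)
    ^-∈ zero    _  = ε-∈
    ^-∈ (suc n) kx = ∙-∈ kx (^-∈ n kx)

    [,]-∈ : ∀ {x y} → K x → K y → K [ x , y ]
    [,]-∈ kx ky = ∙-∈ (∙-∈ (∙-∈ (⁻¹-∈ kx) (⁻¹-∈ ky)) kx) ky

    -- w = w ^ (2m+1) · ((w ^ 2) ^ m)⁻¹, and w ^ 2 ∈ K by induction on a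
    coprime-powers-∈ : ∀ a m {w} → K (w ^ 2 ℕ.^ a) → K (w ^ suc (2 * m)) → K w
    coprime-powers-∈ zero    m {w} w¹∈K _ = subst K (identityʳ w) w¹∈K
    coprime-powers-∈ (suc a) m {w} w^2^[1+a]∈K w^odd∈K =
      subst K w^[2m+1]∙w⁻²ᵐ≡w (∙-∈ w^odd∈K (⁻¹-∈ (^-∈ m w²∈K)))
      where
      w²∈K : K (w ^ 2)
      w²∈K = coprime-powers-∈ a m
        (subst K (^-* w 2 (2 ℕ.^ a)) w^2^[1+a]∈K)
        (subst K (^-^-comm w (suc (2 * m)) 2) (^-∈ 2 w^odd∈K))
      w^[2m+1]∙w⁻²ᵐ≡w : w ^ suc (2 * m) ∙ ((w ^ 2) ^ m) ⁻¹ ≡ w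
      w^[2m+1]∙w⁻²ᵐ≡w = begin
        w ∙ w ^ (2 * m) ∙ ((w ^ 2) ^ m) ⁻¹  ≡⟨ cong (λ u → w ∙ u ∙ ((w ^ 2) ^ m) ⁻¹) (^-* w 2 m) ⟩
        w ∙ (w ^ 2) ^ m ∙ ((w ^ 2) ^ m) ⁻¹  ≡⟨ solve (x₀ · x₁ · x₁ ′) x₀ refl (w ∷ (w ^ 2) ^ m ∷ []) ⟩
        w                                   ∎

  open IsSubgroupPred using (^-∈)

  infix 4 _∈⟨_⟩
  _∈⟨_⟩ : Elt → Elt → Set₁
  u ∈⟨ z ⟩ = ∀ {K} → IsSubgroupPred K → K z → K u

  ∈⟨⟩-refl : ∀ z → z ∈⟨ z ⟩
  ∈⟨⟩-refl z _ z∈K = z∈K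

  ∈⟨⟩-trans : ∀ {z u w} → u ∈⟨ z ⟩ → w ∈⟨ u ⟩ → w ∈⟨ z ⟩
  ∈⟨⟩-trans u∈ w∈ K≤ z∈K = w∈ K≤ (u∈ K≤ z∈K)

  ∙-∈⟨⟩ : ∀ {z u w} → u ∈⟨ z ⟩ → w ∈⟨ z ⟩ → u ∙ w ∈⟨ z ⟩
  ∙-∈⟨⟩ u∈ w∈ K≤ z∈K = IsSubgroupPred.∙-∈ K≤ (u∈ K≤ z∈K) (w∈ K≤ z∈K)

  ⁻¹-∈⟨⟩ : ∀ {z u} → u ∈⟨ z ⟩ → u ⁻¹ ∈⟨ z ⟩
  ⁻¹-∈⟨⟩ u∈ K≤ z∈K = IsSubgroupPred.⁻¹-∈ K≤ (u∈ K≤ z∈K)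

  ^-∈⟨⟩ : ∀ {z u} n → u ∈⟨ z ⟩ → u ^ n ∈⟨ z ⟩
  ^-∈⟨⟩ n u∈ K≤ z∈K = ^-∈ K≤ n (u∈ K≤ z∈K)

  Commute : Elt → Elt → Set
  Commute x y = x ∙ y ≡ y ∙ x

  centraliser : ∀ y → IsSubgroupPred (λ x → Commute x y)
  centraliser y = record
    { ε-∈  = trans (identityˡ y) (sym (identityʳ y))
    ; ∙-∈  = λ {x} {x′} xy x′y → begin
        x ∙ x′ ∙ y    ≡⟨ solve (x₀ · x₁ · x₂) (x₀ · (x₁ · x₂)) refl (x ∷ x′ ∷ y ∷ []) ⟩
        x ∙ (x′ ∙ y)  ≡⟨ cong (x ∙_) x′y ⟩
        x ∙ (y ∙ x′)  ≡⟨ solve (x₀ · (x₁ · x₂)) (x₀ · x₁ · x₂) refl (x ∷ y ∷ x′ ∷ []) ⟩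
        x ∙ y ∙ x′    ≡⟨ cong (_∙ x′) xy ⟩
        y ∙ x ∙ x′    ≡⟨ solve (x₀ · x₁ · x₂) (x₀ · (x₁ · x₂)) refl (y ∷ x ∷ x′ ∷ []) ⟩
        y ∙ (x ∙ x′)  ∎
    ; ⁻¹-∈ = λ {x} xy → begin
        x ⁻¹ ∙ y              ≡⟨ solve (x₀ ′ · x₁) (x₀ ′ · (x₁ · x₀) · x₀ ′) refl (x ∷ y ∷ []) ⟩
        x ⁻¹ ∙ (y ∙ x) ∙ x ⁻¹  ≡⟨ cong (λ t → x ⁻¹ ∙ t ∙ x ⁻¹) (sym xy) ⟩
        x ⁻¹ ∙ (x ∙ y) ∙ x ⁻¹  ≡⟨ solve (x₀ ′ · (x₀ · x₁) · x₀ ′) (x₁ · x₀ ′) refl (x ∷ y ∷ []) ⟩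
        y ∙ x ⁻¹              ∎
    }

  ∈⟨⟩-commute : ∀ {z u w} → u ∈⟨ z ⟩ → w ∈⟨ z ⟩ → Commute u w
  ∈⟨⟩-commute {z} u∈ w∈ = u∈ (centraliser _) (sym (w∈ (centraliser z) refl))

  ^-distrib-∙ : ∀ {x y} → Commute x y → ∀ n → (x ∙ y) ^ n ≡ x ^ n ∙ y ^ n
  ^-distrib-∙         xy zero    = sym (identityˡ ε)
  ^-distrib-∙ {x} {y} xy (suc n) = begin
    x ∙ y ∙ (x ∙ y) ^ n      ≡⟨ cong (x ∙ y ∙_) (^-distrib-∙ xy n) ⟩
    x ∙ y ∙ (x ^ n ∙ y ^ n)  ≡⟨ solve (x₀ · x₁ · (x₂ · x₃)) (x₀ · (x₁ · x₂) · x₃) refl (x ∷ y ∷ x ^ n ∷ y ^ n ∷ []) ⟩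
    x ∙ (y ∙ x ^ n) ∙ y ^ n  ≡⟨ cong (λ t → x ∙ t ∙ y ^ n) (sym (^-∈ (centraliser y) n xy)) ⟩
    x ∙ (x ^ n ∙ y) ∙ y ^ n  ≡⟨ solve (x₀ · (x₂ · x₁) · x₃) (x₀ · x₂ · (x₁ · x₃)) refl (x ∷ y ∷ x ^ n ∷ y ^ n ∷ []) ⟩
    x ∙ x ^ n ∙ (y ∙ y ^ n)  ∎

  finite-order : ∀ z → ∃ λ n → z ^ suc n ≡ ε
  finite-order z with i , j , i<j , zⁱ≡zʲ ← Fin.pigeonhole (n<1+n order) (λ i → z ^ toℕ i)
                 with d , i+1+d≡j ← m≤n⇒∃[o]m+o≡n i<j =
    d , identityʳ-unique (z ^ toℕ i) _ (begin
      z ^ toℕ i ∙ z ^ suc d  ≡⟨ sym (^-+ z (toℕ i) (suc d)) ⟩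
      z ^ (toℕ i + suc d)    ≡⟨ cong (z ^_) (trans (+-suc (toℕ i) d) i+1+d≡j) ⟩
      z ^ toℕ j              ≡⟨ sym zⁱ≡zʲ ⟩
      z ^ toℕ i              ∎)

  IsTwoElement : Elt → Set
  IsTwoElement x = ∃ λ a → x ^ 2 ℕ.^ a ≡ ε

  HasOddOrder : Elt → Set
  HasOddOrder y = ∃ λ m → y ^ suc (2 * m) ≡ ε

  record TwoOddDecomposition (z : Elt) : Set₁ where
    field
      p q    : Elt
      p-two  : IsTwoElement p
      q-odd  : HasOddOrder q
      z≡p∙q  : z ≡ p ∙ q
      p∈⟨z⟩  : p ∈⟨ z ⟩
      q∈⟨z²⟩ : q ∈⟨ z ^ 2 ⟩

    q∈⟨z⟩ : q ∈⟨ z ⟩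
    q∈⟨z⟩ = ∈⟨⟩-trans (^-∈⟨⟩ 2 (∈⟨⟩-refl z)) q∈⟨z²⟩

  odd-square-root : ∀ {z} m → z ^ suc (2 * m) ≡ ε → (z ^ 2) ^ suc m ≡ z
  odd-square-root {z} m z^odd≡ε = begin
    (z ^ 2) ^ suc m          ≡⟨ sym (^-* z 2 (suc m)) ⟩
    z ^ (2 * suc m)          ≡⟨ cong (z ^_) (*-suc 2 m) ⟩
    z ∙ z ^ suc (2 * m)      ≡⟨ cong (z ∙_) z^odd≡ε ⟩
    z ∙ ε                    ≡⟨ identityʳ z ⟩
    z                        ∎

  decompose-odd : ∀ {z} m → z ^ suc (2 * m) ≡ ε → TwoOddDecomposition z
  decompose-odd {z} m z^odd≡ε = record
    { p      = ε
    ; q      = z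
    ; p-two  = 0 , identityˡ ε
    ; q-odd  = m , z^odd≡ε
    ; z≡p∙q  = sym (identityˡ z)
    ; p∈⟨z⟩  = λ K≤ _ → IsSubgroupPred.ε-∈ K≤
    ; q∈⟨z²⟩ = λ {K} K≤ z²∈K → subst K (odd-square-root m z^odd≡ε) (^-∈ K≤ (suc m) z²∈K)
    }

  -- The odd part of z is the square root q′ ^ (m + 1) of the odd part q′ of z², and z q⁻¹ squares to p′.
  decompose-from-square : ∀ {z} → TwoOddDecomposition (z ^ 2) → TwoOddDecomposition z
  decompose-from-square {z} record { p = p′ ; q = q′ ; p-two = b , p′^2^b≡ε ; q-odd = m , q′^[2m+1]≡ε
                                   ; z≡p∙q = z²≡p′q′ ; q∈⟨z²⟩ = q′∈⟨z⁴⟩ } = record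
    { p      = z ∙ q ⁻¹
    ; q      = q
    ; p-two  = suc b , (begin
        (z ∙ q ⁻¹) ^ (2 * 2 ℕ.^ b)     ≡⟨ ^-* (z ∙ q ⁻¹) 2 (2 ℕ.^ b) ⟩
        ((z ∙ q ⁻¹) ^ 2) ^ 2 ℕ.^ b     ≡⟨ cong (_^ 2 ℕ.^ b) p²≡p′ ⟩
        p′ ^ 2 ℕ.^ b                  ≡⟨ p′^2^b≡ε ⟩
        ε                             ∎)
    ; q-odd  = m , (begin
        (q′ ^ suc m) ^ suc (2 * m)    ≡⟨ ^-^-comm q′ (suc m) (suc (2 * m)) ⟩
        (q′ ^ suc (2 * m)) ^ suc m    ≡⟨ cong (_^ suc m) q′^[2m+1]≡ε ⟩
        ε ^ suc m                     ≡⟨ ε^ (suc m) ⟩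
        ε                             ∎)
    ; z≡p∙q  = solve x₀ (x₀ · x₁ ′ · x₁) refl (z ∷ q ∷ [])
    ; p∈⟨z⟩  = ∙-∈⟨⟩ (∈⟨⟩-refl z) (⁻¹-∈⟨⟩ q∈⟨z⟩)
    ; q∈⟨z²⟩ = q∈⟨z²⟩
    }
    where
    q : Elt
    q = q′ ^ suc m
    q∈⟨z²⟩ : q ∈⟨ z ^ 2 ⟩
    q∈⟨z²⟩ = ^-∈⟨⟩ (suc m) (∈⟨⟩-trans (^-∈⟨⟩ 2 (∈⟨⟩-refl (z ^ 2))) q′∈⟨z⁴⟩)
    q∈⟨z⟩ : q ∈⟨ z ⟩
    q∈⟨z⟩ = ∈⟨⟩-trans (^-∈⟨⟩ 2 (∈⟨⟩-refl z)) q∈⟨z²⟩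
    p²≡p′ : (z ∙ q ⁻¹) ^ 2 ≡ p′
    p²≡p′ = begin
      (z ∙ q ⁻¹) ^ 2              ≡⟨ ^-distrib-∙ (∈⟨⟩-commute (∈⟨⟩-refl z) (⁻¹-∈⟨⟩ q∈⟨z⟩)) 2 ⟩
      z ^ 2 ∙ (q ⁻¹) ^ 2          ≡⟨ cong (z ^ 2 ∙_) (solve (x₀ ′ · (x₀ ′ · e)) ((x₀ · (x₀ · e)) ′) refl (q ∷ [])) ⟩
      z ^ 2 ∙ (q ^ 2) ⁻¹          ≡⟨ cong₂ (λ s t → s ∙ t ⁻¹) z²≡p′q′ (trans (^-^-comm q′ (suc m) 2) (odd-square-root m q′^[2m+1]≡ε)) ⟩
      p′ ∙ q′ ∙ q′ ⁻¹             ≡⟨ solve (x₀ · x₁ · x₁ ′) x₀ refl (p′ ∷ q′ ∷ []) ⟩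
      p′                          ∎

  decompose : ∀ z → TwoOddDecomposition z
  decompose z with n , zⁿ⁺¹≡ε ← finite-order z
              with a , m , n+1≡2ᵃ[2m+1] ← 2-adic-decomposition n =
    go a (trans (cong (z ^_) (sym n+1≡2ᵃ[2m+1])) zⁿ⁺¹≡ε)
    where
    go : ∀ a {z} → z ^ (2 ℕ.^ a * suc (2 * m)) ≡ ε → TwoOddDecomposition z
    go zero    {z} z^odd≡ε = decompose-odd m (trans (cong (z ^_) (sym (*-identityˡ (suc (2 * m))))) z^odd≡ε)
    go (suc a) {z} z^2^[1+a]m≡ε = decompose-from-square (go a (begin
      (z ^ 2) ^ (2 ℕ.^ a * suc (2 * m))  ≡⟨ sym (^-* z 2 (2 ℕ.^ a * suc (2 * m))) ⟩
      z ^ (2 * (2 ℕ.^ a * suc (2 * m)))  ≡⟨ cong (z ^_) (sym (*-assoc 2 (2 ℕ.^ a) (suc (2 * m)))) ⟩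
      z ^ (2 ℕ.^ suc a * suc (2 * m))    ≡⟨ z^2^[1+a]m≡ε ⟩
      ε                                  ∎))

  record IsNormalSubgroupPred (K : Elt → Set) : Set where
    field
      isSubgroup : IsSubgroupPred K
      conj-∈     : ∀ h {x} → K x → K (h ⁻¹ ∙ x ∙ h)
    open IsSubgroupPred isSubgroup public

  [ε,-] : ∀ g → [ ε , g ] ≡ ε
  [ε,-] g = solve (e ′ · x₀ ′ · e · x₀) e refl (g ∷ [])

  [-,ε] : ∀ x → [ x , ε ] ≡ ε
  [-,ε] x = solve (x₀ ′ · e ′ · x₀ · e) e refl (x ∷ [])

  [∙,-] : ∀ x y g → [ x ∙ y , g ] ≡ y ⁻¹ ∙ [ x , g ] ∙ y ∙ [ y , g ]
  [∙,-] x y g = solve ((x₀ · x₁) ′ · x₂ ′ · (x₀ · x₁) · x₂)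
                      (x₁ ′ · (x₀ ′ · x₂ ′ · x₀ · x₂) · x₁ · (x₁ ′ · x₂ ′ · x₁ · x₂)) refl (x ∷ y ∷ g ∷ [])

  [-,∙] : ∀ x y g → [ x , y ∙ g ] ≡ [ x , g ] ∙ (g ⁻¹ ∙ [ x , y ] ∙ g)
  [-,∙] x y g = solve (x₀ ′ · (x₁ · x₂) ′ · x₀ · (x₁ · x₂))
                      ((x₀ ′ · x₂ ′ · x₀ · x₂) · (x₂ ′ · (x₀ ′ · x₁ ′ · x₀ · x₁) · x₂)) refl (x ∷ y ∷ g ∷ [])

  [⁻¹,-] : ∀ x g → [ x ⁻¹ , g ] ≡ x ⁻¹ ⁻¹ ∙ [ x , g ] ⁻¹ ∙ x ⁻¹
  [⁻¹,-] x g = solve (x₀ ′ ′ · x₁ ′ · x₀ ′ · x₁) (x₀ ′ ′ · (x₀ ′ · x₁ ′ · x₀ · x₁) ′ · x₀ ′) refl (x ∷ g ∷ [])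

  [conj,-] : ∀ h x g → [ h ⁻¹ ∙ x ∙ h , g ] ≡ h ⁻¹ ∙ [ x , h ∙ g ∙ h ⁻¹ ] ∙ h
  [conj,-] h x g = solve ((x₀ ′ · x₁ · x₀) ′ · x₂ ′ · (x₀ ′ · x₁ · x₀) · x₂)
                         (x₀ ′ · (x₁ ′ · (x₀ · x₂ · x₀ ′) ′ · x₁ · (x₀ · x₂ · x₀ ′)) · x₀) refl (h ∷ x ∷ g ∷ [])

  upperCentral-normal : ∀ i → IsNormalSubgroupPred (UpperCentral i)
  upperCentral-normal zero = record
    { isSubgroup = record
      { ε-∈  = refl
      ; ∙-∈  = λ { refl refl → identityˡ ε }
      ; ⁻¹-∈ = λ { refl → ε⁻¹≈ε }
      }
    ; conj-∈ = λ { h refl → solve (x₀ ′ · e · x₀) e refl (h ∷ []) }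
    }
  upperCentral-normal (suc i) = record
    { isSubgroup = record
      { ε-∈  = λ g → subst (UpperCentral i) (sym ([ε,-] g)) Zᵢ.ε-∈
      ; ∙-∈  = λ {x} {y} x∈Z y∈Z g →
          subst (UpperCentral i) (sym ([∙,-] x y g)) (Zᵢ.∙-∈ (Zᵢ.conj-∈ y (x∈Z g)) (y∈Z g))
      ; ⁻¹-∈ = λ {x} x∈Z g →
          subst (UpperCentral i) (sym ([⁻¹,-] x g)) (Zᵢ.conj-∈ (x ⁻¹) (Zᵢ.⁻¹-∈ (x∈Z g)))
      }
    ; conj-∈ = λ h {x} x∈Z g →
        subst (UpperCentral i) (sym ([conj,-] h x g)) (Zᵢ.conj-∈ h (x∈Z (h ∙ g ∙ h ⁻¹)))
    }
    where module Zᵢ = IsNormalSubgroupPred (upperCentral-normal i)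

  module Modulo {K : Elt → Set} (K⊴G : IsNormalSubgroupPred K) where
    open IsNormalSubgroupPred K⊴G

    infix 4 _≈_
    _≈_ : Elt → Elt → Set
    a ≈ b = K (a ⁻¹ ∙ b)

    ≈-reflexive : ∀ {a b} → a ≡ b → a ≈ b
    ≈-reflexive {a} refl = subst K (sym (inverseˡ a)) ε-∈

    ≈-trans : ∀ {a b c} → a ≈ b → b ≈ c → a ≈ c
    ≈-trans {a} {b} {c} a≈b b≈c =
      subst K (solve (x₀ ′ · x₁ · (x₁ ′ · x₂)) (x₀ ′ · x₂) refl (a ∷ b ∷ c ∷ [])) (∙-∈ a≈b b≈c)

    ∙-cong : ∀ {a a′ b b′} → a ≈ a′ → b ≈ b′ → a ∙ b ≈ a′ ∙ b′
    ∙-cong {a} {a′} {b} {b′} a≈a′ b≈b′ =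
      subst K (solve (x₂ ′ · (x₀ ′ · x₁) · x₂ · (x₂ ′ · x₃)) ((x₀ · x₂) ′ · (x₁ · x₃)) refl (a ∷ a′ ∷ b ∷ b′ ∷ []))
        (∙-∈ (conj-∈ b a≈a′) b≈b′)

    ≈ε⇒∈ : ∀ {a} → a ≈ ε → K a
    ≈ε⇒∈ {a} a≈ε = subst K (trans (cong _⁻¹ (identityʳ (a ⁻¹))) (⁻¹-involutive a)) (⁻¹-∈ a≈ε)

  module _ (j : ℕ) where
    open IsNormalSubgroupPred (upperCentral-normal j) using () renaming (isSubgroup to Zⱼ≤G)
    open Modulo (upperCentral-normal j)

    conj-≈ : ∀ {w} h → UpperCentral (suc j) w → w ≈ h ⁻¹ ∙ w ∙ h
    conj-≈ {w} h w∈Zⱼ₊₁ =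
      subst (UpperCentral j) (solve (x₀ ′ · x₁ ′ · x₀ · x₁) (x₀ ′ · (x₁ ′ · x₀ · x₁)) refl (w ∷ h ∷ [])) (w∈Zⱼ₊₁ h)

    [-,^]≈^ : ∀ {u v} → UpperCentral (suc j) [ u , v ] → ∀ r → [ u , v ] ^ r ≈ [ u , v ^ r ]
    [-,^]≈^ {u} {v} c∈Zⱼ₊₁ zero    = ≈-reflexive (sym ([-,ε] u))
    [-,^]≈^ {u} {v} c∈Zⱼ₊₁ (suc r) = ≈-trans
      (≈-reflexive (∈⟨⟩-commute (∈⟨⟩-refl [ u , v ]) (^-∈⟨⟩ r (∈⟨⟩-refl [ u , v ]))))
      (≈-trans (∙-cong ([-,^]≈^ c∈Zⱼ₊₁ r) (conj-≈ (v ^ r) c∈Zⱼ₊₁)) (≈-reflexive (sym ([-,∙] u v (v ^ r)))))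

    [^,-]≈^ : ∀ {u v} → UpperCentral (suc j) [ u , v ] → ∀ r → [ u , v ] ^ r ≈ [ u ^ r , v ]
    [^,-]≈^ {u} {v} c∈Zⱼ₊₁ zero    = ≈-reflexive (sym ([ε,-] v))
    [^,-]≈^ {u} {v} c∈Zⱼ₊₁ (suc r) =
      ≈-trans (∙-cong (conj-≈ (u ^ r) c∈Zⱼ₊₁) ([^,-]≈^ c∈Zⱼ₊₁ r)) (≈-reflexive (sym ([∙,-] u (u ^ r) v)))

    commutator-descends : ∀ {x y} → IsTwoElement x → HasOddOrder y →
                          UpperCentral (suc j) [ x , y ] → UpperCentral j [ x , y ]
    commutator-descends {x} {y} (a , x^2^a≡ε) (m , y^odd≡ε) c∈Zⱼ₊₁ = IsSubgroupPred.coprime-powers-∈ Zⱼ≤G a m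
      (≈ε⇒∈ (≈-trans ([^,-]≈^ c∈Zⱼ₊₁ (2 ℕ.^ a)) (≈-reflexive (trans (cong [_, y ] x^2^a≡ε) ([ε,-] y)))))
      (≈ε⇒∈ (≈-trans ([-,^]≈^ c∈Zⱼ₊₁ (suc (2 * m))) (≈-reflexive (trans (cong [ x ,_] y^odd≡ε) ([-,ε] x)))))

  nilpotent⇒two-commutes-with-odd : IsNilpotent → ∀ {x y} → IsTwoElement x → HasOddOrder y → Commute x y
  nilpotent⇒two-commutes-with-odd (c , all∈Zc) {x} {y} x-two y-odd = begin
    x ∙ y                ≡⟨ solve (x₀ · x₁) (x₁ · x₀ · (x₀ ′ · x₁ ′ · x₀ · x₁)) refl (x ∷ y ∷ []) ⟩
    y ∙ x ∙ [ x , y ]    ≡⟨ cong (y ∙ x ∙_) (descend c (all∈Zc [ x , y ])) ⟩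
    y ∙ x ∙ ε            ≡⟨ identityʳ (y ∙ x) ⟩
    y ∙ x                ∎
    where
    descend : ∀ j → UpperCentral j [ x , y ] → [ x , y ] ≡ ε
    descend zero    c∈Z₀   = c∈Z₀
    descend (suc j) c∈Zⱼ₊₁ = descend j (commutator-descends j x-two y-odd c∈Zⱼ₊₁)

  isSubgroupPred : ∀ {S} → IsSubgroup S → IsSubgroupPred (_∈ S)
  isSubgroupPred S≤G = record { ε-∈ = ε-∈ ; ∙-∈ = ∙-∈ ; ⁻¹-∈ = ⁻¹-∈ }
    where open IsSubgroup S≤G

  module LeftCosets {H : Subset order} (H≤G : IsSubgroup H) where
    open IsSubgroup H≤G

    infix 4 _∼_
    _∼_ : Elt → Elt → Set
    u ∼ w = u ⁻¹ ∙ w ∈ H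

    ∼-isDecEquivalence : IsDecEquivalence _∼_
    ∼-isDecEquivalence = record
      { isEquivalence = record
        { refl  = λ {u} → subst (_∈ H) (sym (inverseˡ u)) ε-∈
        ; sym   = λ {u} {w} u∼w → subst (_∈ H) (solve ((x₀ ′ · x₁) ′) (x₁ ′ · x₀) refl (u ∷ w ∷ [])) (⁻¹-∈ u∼w)
        ; trans = λ {u} {v} {w} u∼v v∼w →
            subst (_∈ H) (solve (x₀ ′ · x₁ · (x₁ ′ · x₂)) (x₀ ′ · x₂) refl (u ∷ v ∷ w ∷ [])) (∙-∈ u∼v v∼w)
        }
      ; _≟_ = λ u w → u ⁻¹ ∙ w ∈? H
      }

    open IsDecEquivalence ∼-isDecEquivalence public using (_≟_) renaming (refl to ∼-refl; sym to ∼-sym; trans to ∼-trans)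

    ∙-cong : ∀ y {u w} → u ∼ w → y ∙ u ∼ y ∙ w
    ∙-cong y {u} {w} = subst (_∈ H) (solve (x₁ ′ · x₂) ((x₀ · x₁) ′ · (x₀ · x₂)) refl (y ∷ u ∷ w ∷ []))

    coset-size : ∀ c → count (c ≟_) ≡ ∣ H ∣
    coset-size c = trans (count-∘-bijection (_∈? H) (c ⁻¹ ∙_) (c ∙_)
                           (λ w → solve (x₀ ′ · (x₀ · x₁)) x₁ refl (c ∷ w ∷ []))
                           (λ w → solve (x₀ · (x₀ ′ · x₁)) x₁ refl (c ∷ w ∷ [])))
                         (count-∈ H)

  -- A j is the union of the cosets uH ⊆ S fixed by x ^ 2 ^ j.  It is empty for j = 0, it is S for
  -- j = a, and pairing the cosets swapped by x ^ 2 ^ j shows |A (j + 1)| ≡ |A j| modulo 2|H|.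
  two-element-without-fixed-coset⇒index-even :
    ∀ {S H} → IsSubgroup S → IsSubgroup H → (∀ {h} → h ∈ H → h ∈ S) →
    ∀ {x} → x ∈ S → IsTwoElement x → (∀ {s} → s ∈ S → s ⁻¹ ∙ (x ∙ s) ∉ H) → IndexEven S H
  two-element-without-fixed-coset⇒index-even {S} {H} S≤G H≤G H⊆S {x} x∈S (a , x^2^a≡ε) no-fixed-coset =
    Product.map₂ (λ {k} ∣A-a∣≡2k∣H∣ → begin
      ∣ S ∣           ≡⟨ sym (count-∈ S) ⟩
      count (_∈? S)   ≡⟨ count-cong (_∈? S) (A? a) (λ u∈S → u∈S , fixed-by-x^2^a) proj₁ ⟩
      count (A? a)    ≡⟨ ∣A-a∣≡2k∣H∣ ⟩
      2 * k * ∣ H ∣   ∎)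
      (count-A a)
    where
    open LeftCosets H≤G
    module ∈S = IsSubgroup S≤G

    A : ℕ → Pred Elt 0ℓ
    A j u = u ∈ S × u ∼ x ^ 2 ℕ.^ j ∙ u

    A? : ∀ j → Decidable (A j)
    A? j = (_∈? S) ∩? (λ u → u ≟ x ^ 2 ℕ.^ j ∙ u)

    fixed-by-x^2^a : ∀ {u} → u ∼ x ^ 2 ℕ.^ a ∙ u
    fixed-by-x^2^a {u} = subst (λ t → u ∼ t ∙ u) (sym x^2^a≡ε) (subst (u ∼_) (sym (identityˡ u)) ∼-refl)

    count-A-suc : ∀ j → ∃ λ k → count (A? (suc j)) ≡ count (A? j) + 2 * k * ∣ H ∣
    count-A-suc j = Product.map₂ (λ {k} eq → trans eq (cong (_+ 2 * k * ∣ H ∣) fixed-points))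
                      (count≡fixed+pairs (A? (suc j)) A-stable)
      where
      y : Elt
      y = x ^ 2 ℕ.^ j
      open ClassInvolution ∼-isDecEquivalence ∣ H ∣ coset-size (y ∙_) (∙-cong y)
      y²∙ : ∀ u → x ^ 2 ℕ.^ suc j ∙ u ≡ y ∙ (y ∙ u)
      y²∙ u = trans (cong (_∙ u) (trans (cong (x ^_) (*-comm 2 (2 ℕ.^ j))) (^-* x (2 ℕ.^ j) 2)))
                    (solve (x₀ · (x₀ · e) · x₁) (x₀ · (x₀ · x₁)) refl (y ∷ u ∷ []))
      A-stable : Stable (A (suc j))
      A-stable = record
        { ∼-closed     = λ {u} {w} (u∈S , u∼y²u) u∼w →
            subst (_∈ S) (solve (x₀ · (x₀ ′ · x₁)) x₁ refl (u ∷ w ∷ [])) (∈S.∙-∈ u∈S (H⊆S u∼w)) ,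
            ∼-trans (∼-sym u∼w) (∼-trans u∼y²u (∙-cong (x ^ 2 ℕ.^ suc j) u∼w))
        ; f-closed     = λ {u} (u∈S , u∼y²u) →
            ∈S.∙-∈ (^-∈ (isSubgroupPred S≤G) (2 ℕ.^ j) x∈S) u∈S ,
            subst (y ∙ u ∼_) (trans (cong (y ∙_) (y²∙ u)) (sym (y²∙ (y ∙ u)))) (∙-cong y u∼y²u)
        ; f-involutive = λ {u} (_ , u∼y²u) → ∼-sym (subst (u ∼_) (y²∙ u) u∼y²u)
        }
      fixed-points : count (A? (suc j) ∩? fixed?) ≡ count (A? j)
      fixed-points = count-cong (A? (suc j) ∩? fixed?) (A? j) (λ ((u∈S , _) , u∼yu) → u∈S , u∼yu)
        λ {u} (u∈S , u∼yu) → (u∈S , subst (u ∼_) (sym (y²∙ u)) (∼-trans u∼yu (∙-cong y u∼yu))) , u∼yu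

    count-A : ∀ j → ∃ λ k → count (A? j) ≡ 2 * k * ∣ H ∣
    count-A zero = 0 , count-∅ (A? 0) λ u (u∈S , u∼x¹u) →
      no-fixed-coset u∈S (subst (λ t → u ∼ t ∙ u) (identityʳ x) u∼x¹u)
    count-A (suc j) with K , eqK ← count-A j | k , eqk ← count-A-suc j =
      K + k , trans eqk (trans (cong (_+ 2 * k * ∣ H ∣) eqK) (2Kh+2kh≡2[K+k]h K k ∣ H ∣))

  ∈-conj : ∀ {g S x} → x ∈ conj g S ⇔ g ⁻¹ ∙ x ∙ g ∈ S
  ∈-conj {g} {S} {x} = mk⇔
    (λ x∈T → lookup⇒[]= _ S (trans (sym (lookup∘tabulate conjugated x)) ([]=⇒lookup x∈T)))
    (λ g⁻¹xg∈S → lookup⇒[]= x (conj g S) (trans (lookup∘tabulate conjugated x) ([]=⇒lookup g⁻¹xg∈S)))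
    where
    conjugated : Elt → Bool
    conjugated y = lookup S (g ⁻¹ ∙ y ∙ g)

  conj-isSubgroup : ∀ {S} → IsSubgroup S → ∀ g → IsSubgroup (conj g S)
  conj-isSubgroup {S} S≤G g = record
    { ε-∈  = from ∈-conj (subst (_∈ S) (sym (solve (x₀ ′ · e · x₀) e refl (g ∷ []))) ε-∈)
    ; ∙-∈  = λ {x} {y} x∈ y∈ → from ∈-conj (subst (_∈ S)
               (solve (x₀ ′ · x₁ · x₀ · (x₀ ′ · x₂ · x₀)) (x₀ ′ · (x₁ · x₂) · x₀) refl (g ∷ x ∷ y ∷ []))
               (∙-∈ (to ∈-conj x∈) (to ∈-conj y∈)))
    ; ⁻¹-∈ = λ {x} x∈ → from ∈-conj (subst (_∈ S)
               (solve ((x₀ ′ · x₁ · x₀) ′) (x₀ ′ · x₁ ′ · x₀) refl (g ∷ x ∷ []))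
               (⁻¹-∈ (to ∈-conj x∈)))
    }
    where
    open IsSubgroup S≤G
    open Equivalence

  ∩-isSubgroup : ∀ {S S′} → IsSubgroup S → IsSubgroup S′ → IsSubgroup (S ∩ S′)
  ∩-isSubgroup {S} {S′} S≤G S′≤G = record
    { ε-∈  = x∈p∩q⁺ (S.ε-∈ , S′.ε-∈)
    ; ∙-∈  = λ x∈ y∈ → let (x∈S , x∈S′) = x∈p∩q⁻ S S′ x∈ ; (y∈S , y∈S′) = x∈p∩q⁻ S S′ y∈
                       in x∈p∩q⁺ (S.∙-∈ x∈S y∈S , S′.∙-∈ x∈S′ y∈S′)
    ; ⁻¹-∈ = λ x∈ → let (x∈S , x∈S′) = x∈p∩q⁻ S S′ x∈ in x∈p∩q⁺ (S.⁻¹-∈ x∈S , S′.⁻¹-∈ x∈S′)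
    }
    where
    module S  = IsSubgroup S≤G
    module S′ = IsSubgroup S′≤G

  conj-∙-∈ : ∀ {S} → IsSubgroup S → ∀ δ {t} → t ∈ S → conj (δ ∙ t) S ≡ conj δ S
  conj-∙-∈ {S} S≤G δ {t} t∈S = ⊆-antisym
    (λ {x} x∈ → from ∈-conj (subst (_∈ S)
      (solve (x₁ · ((x₀ · x₁) ′ · x₂ · (x₀ · x₁)) · x₁ ′) (x₀ ′ · x₂ · x₀) refl (δ ∷ t ∷ x ∷ []))
      (∙-∈ (∙-∈ t∈S (to ∈-conj x∈)) (⁻¹-∈ t∈S))))
    (λ {x} x∈ → from ∈-conj (subst (_∈ S)
      (solve (x₁ ′ · (x₀ ′ · x₂ · x₀) · x₁) ((x₀ · x₁) ′ · x₂ · (x₀ · x₁)) refl (δ ∷ t ∷ x ∷ []))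
      (∙-∈ (∙-∈ (⁻¹-∈ t∈S) (to ∈-conj x∈)) t∈S)))
    where
    open IsSubgroup S≤G
    open Equivalence

  indexEven? : ∀ S H → Dec (IndexEven S H)
  indexEven? S H = Dec.map′
    (λ { (divides k ∣S∣≡k[2∣H∣]) → k , trans ∣S∣≡k[2∣H∣] (k*[2h]≡2k*h k ∣ H ∣) })
    (λ { (k , ∣S∣≡2k∣H∣) → divides k (trans ∣S∣≡2k∣H∣ (sym (k*[2h]≡2k*h k ∣ H ∣))) })
    (2 * ∣ H ∣ ∣? ∣ S ∣)

  module SquareInSubgroup (nilpotent : IsNilpotent) {S : Subset order} (S≤G : IsSubgroup S) {g : Elt} (g²∈S : g ^ 2 ∈ S) where
    open Equivalence

    T H : Subset order
    T = conj g S
    H = S ∩ T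

    S≤ : IsSubgroupPred (_∈ S)
    S≤ = isSubgroupPred S≤G

    T≤ : IsSubgroupPred (_∈ T)
    T≤ = isSubgroupPred (conj-isSubgroup S≤G g)

    module ∈S = IsSubgroupPred S≤
    module ∈T = IsSubgroupPred T≤

    odd∈T : ∀ {y} → y ∈ S → HasOddOrder y → y ∈ T
    odd∈T {y} y∈S y-odd =
      from ∈-conj (subst (_∈ S) (sym g⁻¹yg≡q⁻¹yq) (∈S.∙-∈ (∈S.∙-∈ (∈S.⁻¹-∈ q∈S) y∈S) q∈S))
      where
      open TwoOddDecomposition (decompose g)
      q∈S : q ∈ S
      q∈S = q∈⟨z²⟩ S≤ g²∈S
      g⁻¹yg≡q⁻¹yq : g ⁻¹ ∙ y ∙ g ≡ q ⁻¹ ∙ y ∙ q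
      g⁻¹yg≡q⁻¹yq = begin
        g ⁻¹ ∙ y ∙ g                 ≡⟨ cong (λ t → t ⁻¹ ∙ y ∙ t) z≡p∙q ⟩
        (p ∙ q) ⁻¹ ∙ y ∙ (p ∙ q)     ≡⟨ solve ((x₀ · x₁) ′ · x₂ · (x₀ · x₁)) (x₁ ′ · (x₀ ′ · (x₂ · x₀)) · x₁) refl (p ∷ q ∷ y ∷ []) ⟩
        q ⁻¹ ∙ (p ⁻¹ ∙ (y ∙ p)) ∙ q  ≡⟨ cong (λ t → q ⁻¹ ∙ (p ⁻¹ ∙ t) ∙ q) (sym (nilpotent⇒two-commutes-with-odd nilpotent p-two y-odd)) ⟩
        q ⁻¹ ∙ (p ⁻¹ ∙ (p ∙ y)) ∙ q  ≡⟨ solve (x₁ ′ · (x₀ ′ · (x₀ · x₂)) · x₁) (x₁ ′ · x₂ · x₁) refl (p ∷ q ∷ y ∷ []) ⟩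
        q ⁻¹ ∙ y ∙ q                 ∎

    fixed-coset⇒∈T : ∀ j → (∀ {p} → p ∈ S → IsTwoElement p → UpperCentral j p → p ∈ T) →
                     ∀ {x s} → x ∈ S → IsTwoElement x → UpperCentral (suc j) x →
                     s ∈ S → s ⁻¹ ∙ (x ∙ s) ∈ H → x ∈ T
    fixed-coset⇒∈T j two∈T {x} {s} x∈S x-two@(a , x^2^a≡ε) x∈Zⱼ₊₁ s∈S s⁻¹xs∈H =
      ∈T.coprime-powers-∈ a m (subst (_∈ T) (sym x^2^a≡ε) ∈T.ε-∈) x^[2m+1]∈T
      where
      open TwoOddDecomposition (decompose [ x , s ])
      m : ℕ
      m = proj₁ q-odd
      p∈T : p ∈ T
      p∈T = two∈T (p∈⟨z⟩ S≤ (∈S.[,]-∈ x∈S s∈S)) p-two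
              (p∈⟨z⟩ (IsNormalSubgroupPred.isSubgroup (upperCentral-normal j)) (x∈Zⱼ₊₁ s))
      xq≡s⁻¹xsp⁻¹ : x ∙ q ≡ s ⁻¹ ∙ (x ∙ s) ∙ p ⁻¹
      xq≡s⁻¹xsp⁻¹ = begin
        x ∙ q                  ≡⟨ solve (x₀ · x₁) (x₀ · (x₁ · x₂) · x₂ ′) refl (x ∷ q ∷ p ∷ []) ⟩
        x ∙ (q ∙ p) ∙ p ⁻¹     ≡⟨ cong (λ t → x ∙ t ∙ p ⁻¹) (sym (trans z≡p∙q (∈⟨⟩-commute p∈⟨z⟩ q∈⟨z⟩))) ⟩
        x ∙ [ x , s ] ∙ p ⁻¹   ≡⟨ solve (x₀ · (x₀ ′ · x₁ ′ · x₀ · x₁) · x₂ ′) (x₁ ′ · (x₀ · x₁) · x₂ ′) refl (x ∷ s ∷ p ∷ []) ⟩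
        s ⁻¹ ∙ (x ∙ s) ∙ p ⁻¹  ∎
      xq∈T : x ∙ q ∈ T
      xq∈T = subst (_∈ T) (sym xq≡s⁻¹xsp⁻¹) (∈T.∙-∈ (proj₂ (x∈p∩q⁻ S T s⁻¹xs∈H)) (∈T.⁻¹-∈ p∈T))
      x^[2m+1]∈T : x ^ suc (2 * m) ∈ T
      x^[2m+1]∈T = subst (_∈ T)
        (trans (^-distrib-∙ (nilpotent⇒two-commutes-with-odd nilpotent x-two q-odd) (suc (2 * m)))
               (trans (cong (x ^ suc (2 * m) ∙_) (proj₂ q-odd)) (identityʳ _)))
        (∈T.^-∈ (suc (2 * m)) xq∈T)

    module _ (odd : ¬ IndexEven S H) where

      two∈T : ∀ j {x} → x ∈ S → IsTwoElement x → UpperCentral j x → x ∈ T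
      two∈T zero    _ _ refl = ∈T.ε-∈
      two∈T (suc j) {x} x∈S x-two x∈Zⱼ₊₁ with x ∈? T
      ... | yes x∈T = x∈T
      ... | no  x∉T = contradiction
        (two-element-without-fixed-coset⇒index-even S≤G (∩-isSubgroup S≤G (conj-isSubgroup S≤G g))
           (λ {h} h∈H → proj₁ (x∈p∩q⁻ S T h∈H)) x∈S x-two
           (λ s∈S s⁻¹xs∈H → x∉T (fixed-coset⇒∈T j (two∈T j) x∈S x-two x∈Zⱼ₊₁ s∈S s⁻¹xs∈H)))
        odd

      S⊆T : ∀ {x} → x ∈ S → x ∈ T
      S⊆T {x} x∈S = subst (_∈ T) (sym z≡p∙q)
        (∈T.∙-∈ (two∈T (proj₁ nilpotent) (p∈⟨z⟩ S≤ x∈S) p-two (proj₂ nilpotent p))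
                (odd∈T (q∈⟨z⟩ S≤ x∈S) q-odd))
        where open TwoOddDecomposition (decompose x)

    T⊆S : (∀ {x} → x ∈ S → x ∈ T) → ∀ {x} → x ∈ T → x ∈ S
    T⊆S S⊆T {x} x∈T = subst (_∈ S) g²[g⁻²xg²]g⁻²≡x (∈S.∙-∈ (∈S.∙-∈ g²∈S g⁻²xg²∈S) (∈S.⁻¹-∈ g²∈S))
      where
      g⁻²xg²∈S : g ⁻¹ ∙ (g ⁻¹ ∙ x ∙ g) ∙ g ∈ S
      g⁻²xg²∈S = to ∈-conj (S⊆T (to ∈-conj x∈T))
      g²[g⁻²xg²]g⁻²≡x : g ^ 2 ∙ (g ⁻¹ ∙ (g ⁻¹ ∙ x ∙ g) ∙ g) ∙ (g ^ 2) ⁻¹ ≡ x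
      g²[g⁻²xg²]g⁻²≡x = solve (x₁ · (x₁ · e) · (x₁ ′ · (x₁ ′ · x₀ · x₁) · x₁) · (x₁ · (x₁ · e)) ′) x₀ refl (x ∷ g ∷ [])

    index-even : ¬ SameSet T S → IndexEven S H
    index-even T≠S = decidable-stable (indexEven? S H) λ odd → T≠S λ _ → mk⇔ (T⊆S (S⊆T odd)) (S⊆T odd)

  self-inverse-double-coset⇒square∈ : ∀ {S} → IsSubgroup S → ∀ {δ} →
    (∀ x → InDoubleCoset S δ x ⇔ InDoubleCoset S (δ ⁻¹) x) → ∃ λ t → t ∈ S × (δ ∙ t) ^ 2 ∈ S
  self-inverse-double-coset⇒square∈ {S} S≤G {δ} SδS≡Sδ⁻¹S
    with s , t , s∈S , t∈S , δ⁻¹≡sδt ← Equivalence.from (SδS≡Sδ⁻¹S (δ ⁻¹))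
           (ε , ε , IsSubgroup.ε-∈ S≤G , IsSubgroup.ε-∈ S≤G , solve x₀ (e · x₀ · e) refl (δ ⁻¹ ∷ [])) =
    t , t∈S , subst (_∈ S) (sym [δt]²≡s⁻¹t) (IsSubgroup.∙-∈ S≤G (IsSubgroup.⁻¹-∈ S≤G s∈S) t∈S)
    where
    [δt]²≡s⁻¹t : (δ ∙ t) ^ 2 ≡ s ⁻¹ ∙ t
    [δt]²≡s⁻¹t = begin
      (δ ∙ t) ^ 2                ≡⟨ solve ((x₀ · x₁) · ((x₀ · x₁) · e)) (x₂ ′ · (x₂ · x₀ · x₁) · x₀ · x₁) refl (δ ∷ t ∷ s ∷ []) ⟩
      s ⁻¹ ∙ (s ∙ δ ∙ t) ∙ δ ∙ t  ≡⟨ cong (λ u → s ⁻¹ ∙ u ∙ δ ∙ t) (sym δ⁻¹≡sδt) ⟩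
      s ⁻¹ ∙ δ ⁻¹ ∙ δ ∙ t         ≡⟨ solve (x₂ ′ · x₀ ′ · x₀ · x₁) (x₂ ′ · x₁) refl (δ ∷ t ∷ s ∷ []) ⟩
      s ⁻¹ ∙ t                   ∎

lemma4p6 : (G : FiniteGroup) → FiniteGroup.IsNilpotent G →
    (S : Subset (FiniteGroup.order G)) → FiniteGroup.IsSubgroup G S →
    (δ : FiniteGroup.Elt G) →
    ¬ FiniteGroup.SameSet G (FiniteGroup.conj G δ S) S →
    (∀ x → FiniteGroup.InDoubleCoset G S δ x ⇔ FiniteGroup.InDoubleCoset G S (FiniteGroup._⁻¹ G δ) x) →
    FiniteGroup.IndexEven G S (S ∩ FiniteGroup.conj G δ S)
lemma4p6 G nilpotent S S≤G δ T≠S SδS≡Sδ⁻¹S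
  with t , t∈S , [δt]²∈S ← self-inverse-double-coset⇒square∈ G S≤G SδS≡Sδ⁻¹S =
  subst (λ T → IndexEven S (S ∩ T)) conj[δt]≡conjδ
    (SquareInSubgroup.index-even G nilpotent S≤G [δt]²∈S (subst (λ T → ¬ SameSet T S) (sym conj[δt]≡conjδ) T≠S))
  where
  open FiniteGroup G
  conj[δt]≡conjδ : conj (δ ∙ t) S ≡ conj δ S
  conj[δt]≡conjδ = conj-∙-∈ G S≤G δ t∈S
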